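{- Let $\mathcal{H}=(V,H)$ be a boolean representable simplicial complex. Then: (i) if every singleton $\{p\}$ ($p\in V$) belongs to $H$, then $V$ is the union of the atoms of the lattice of flats $\mathrm{Fl}\,\mathcal{H}$; (ii) the lattice $\mathrm{Fl}\,\mathcal{H}$ is atomistic.
   Context: A (finite) simplicial complex is a pair $\mathcal{H}=(V,H)$ where $V$ is a finite nonempty set and $H\subseteq 2^V$ is nonempty and closed under taking subsets. A subset $X\subseteq V$ is a flat if for every $I\in H$ with $I\subseteq X$ and every $p\in V\setminus X$ we have $I\cup\{p\}\in H$; the flats ordered by inclusion form a lattice $\mathrm{Fl}\,\mathcal{H}$ (meet is intersection). A set $X$ is a transversal of the successive differences for a chain of subsets $A_0\subset A_1\subset\cdots\subset A_k$ if $X$ admits an enumeration $x_1,\dots,x_k$ (distinct elements) with $x_i\in A_i\setminus A_{i-1}$ for $i=1,\dots,k$. $\mathcal{H}$ is boolean representable if every $X\in H$ is a transversal of the successive differences for some chain in $\mathrm{Fl}\,\mathcal{H}$. An atom of a lattice is an element covering the bottom element; a finite lattice is atomistic if every element is a join of atoms (the bottom being the empty join). -}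

module Defs where

open import Data.Nat using (ℕ; suc; _<_)
open import Data.Fin using (Fin; inject₁) renaming (suc to fsuc)
open import Data.Fin.Subset using (Subset; _∈_; _∉_; _⊆_; _⊂_; _∪_; ⁅_⁆)
open import Data.Bool using (Bool; true)
open import Data.List using (List)
open import Data.List.Relation.Unary.All using (All)
open import Data.List.Membership.Propositional using () renaming (_∈_ to _∈L_)
open import Data.Product using (Σ; ∃; _×_)
open import Data.Sum using (_⊎_)
open import Relation.Nullary using (¬_)
open import Function.Definitions using (Injective)
open import Function.Bundles using (_⇔_)
open import Relation.Binary.PropositionalEquality using (_≡_)

record SimplicialComplex (n : ℕ) : Set where
  field
    V-nonempty : 0 < n
    H          : Subset n → Bool
    H-nonempty : ∃ λ I → H I ≡ true
    H-closed   : ∀ I J → J ⊆ I → H I ≡ true → H J ≡ true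

module _ {n : ℕ} (𝓗 : SimplicialComplex n) where
  open SimplicialComplex 𝓗

  InH : Subset n → Set
  InH I = H I ≡ true

  IsFlat : Subset n → Set
  IsFlat X = ∀ I → InH I → I ⊆ X → ∀ p → p ∉ X → InH (I ∪ ⁅ p ⁆)

  -- X is a transversal of the successive differences of A₀ , … , A_k :
  -- an injective enumeration x₁ … x_k of X with x_i ∈ A_i ∖ A_{i-1}.
  IsTransversal : ∀ {k} → Subset n → (Fin (suc k) → Subset n) → Set
  IsTransversal {k} X A =
    Σ (Fin k → Fin n) λ x →
      Injective _≡_ _≡_ x
      × (∀ p → (p ∈ X) ⇔ (∃ λ i → x i ≡ p))
      × (∀ i → (x i ∈ A (fsuc i)) × (x i ∉ A (inject₁ i)))

  IsFlatChain : ∀ {k} → (Fin (suc k) → Subset n) → Set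
  IsFlatChain {k} A = (∀ i → IsFlat (A i)) × (∀ (i : Fin k) → A (inject₁ i) ⊂ A (fsuc i))

  BooleanRepresentable : Set
  BooleanRepresentable =
    ∀ X → InH X → Σ ℕ λ k → Σ (Fin (suc k) → Subset n) λ A →
      IsFlatChain A × IsTransversal X A

  IsBottomFlat : Subset n → Set
  IsBottomFlat B = IsFlat B × (∀ Y → IsFlat Y → B ⊆ Y)

  IsAtom : Subset n → Set
  IsAtom A = IsFlat A × ¬ IsBottomFlat A
    × (∀ Y → IsFlat Y → Y ⊆ A → IsBottomFlat Y ⊎ Y ≡ A)

  IsJoin : List (Subset n) → Subset n → Set
  IsJoin As X = IsFlat X × (∀ A → A ∈L As → A ⊆ X)
    × (∀ Y → IsFlat Y → (∀ A → A ∈L As → A ⊆ Y) → X ⊆ Y)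

  VIsUnionOfAtoms : Set
  VIsUnionOfAtoms = ∀ (p : Fin n) → ∃ λ A → IsAtom A × p ∈ A

  Atomistic : Set
  Atomistic = ∀ X → IsFlat X → ∃ λ (As : List (Subset n)) → All IsAtom As × IsJoin As X

-- Let ⊥ᶠ be the least flat and ⟨ q ⟩ the least flat containing q. Reading boolean
-- representability along the chain of flats that witnesses a face gives two facts:
-- no face meets ⊥ᶠ, and no face contains two distinct points each lying in the
-- closure of the other. With these, ⊥ᶠ together with the points p with ⟨ p ⟩ = ⟨ q ⟩
-- is again a flat, so every point of ⟨ q ⟩ outside ⊥ᶠ generates ⟨ q ⟩. Hence ⟨ q ⟩ is
-- an atom whenever q ∉ ⊥ᶠ, and every flat X is the join of the atoms ⟨ q ⟩ with
-- q ∈ X outside ⊥ᶠ. For (i), a face ⁅ p ⁆ forces p ∉ ⊥ᶠ.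
module Submission where

open import Defs
open import Data.Nat as ℕ using (ℕ; suc; z≤n; s≤s)
open import Data.Fin as Fin using (Fin; inject₁; toℕ) renaming (suc to fsuc; zero to fzero)
open import Data.Fin.Properties using (all?; any?; <-cmp; toℕ-inject₁)
open import Data.Fin.Subset using (Subset; ⁅_⁆; _∈_; _∉_; _⊆_; _∪_) renaming (⊥ to ∅)
open import Data.Fin.Subset.Properties
  using (_∈?_; _⊆?_; anySubset?; ⊥⊆; ⊆-trans; ⊆-antisym; x∈⁅x⁆; x∈⁅y⁆⇒x≡y; x∈p∪q⁺; x∈p∪q⁻; ∪-identityˡ)
open import Data.Bool using (true; _≟_)
open import Data.Bool.Properties using (T-≡)
open import Data.Vec using (tabulate)
open import Data.Vec.Properties using (lookup∘tabulate; []=⇒lookup; lookup⇒[]=)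
open import Data.List using (List; filter; map; allFin)
import Data.List.Relation.Unary.All as All
open import Data.List.Membership.Propositional using () renaming (_∈_ to _∈L_)
open import Data.List.Membership.Propositional.Properties using (∈-map⁺; ∈-map⁻; ∈-filter⁺; ∈-filter⁻; ∈-allFin)
open import Data.Product using (∃; _×_; _,_; proj₁; proj₂)
open import Data.Sum using (_⊎_; inj₁; inj₂; [_,_]′)
open import Data.Empty using (⊥-elim)
open import Function using (_∘_; id)
open import Function.Bundles using (Equivalence)
open import Relation.Binary using (tri<; tri≈; tri>)
open import Relation.Binary.PropositionalEquality using (_≡_; refl; sym; trans; subst)
open import Relation.Nullary using (¬_; Dec; yes; no; isYes; ¬?)
open import Relation.Nullary.Decidable using (toWitness; fromWitness; decidable-stable; map′; _×-dec_; _→-dec_)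
open import Relation.Unary using (Pred; Decidable)

module _ {n ℓ} {P : Pred (Fin n) ℓ} (P? : Decidable P) where

  subsetOf : Subset n
  subsetOf = tabulate (isYes ∘ P?)

  ∈-subsetOf⁺ : ∀ {p} → P p → p ∈ subsetOf
  ∈-subsetOf⁺ {p} Pp =
    lookup⇒[]= p subsetOf (trans (lookup∘tabulate (isYes ∘ P?) p) (Equivalence.to T-≡ (fromWitness {a? = P? p} Pp)))

  ∈-subsetOf⁻ : ∀ {p} → p ∈ subsetOf → P p
  ∈-subsetOf⁻ {p} p∈ =
    toWitness {a? = P? p} (Equivalence.from T-≡ (trans (sym (lookup∘tabulate (isYes ∘ P?) p)) ([]=⇒lookup p∈)))

allSubset? : ∀ {n ℓ} {P : Pred (Subset n) ℓ} → Decidable P → Dec (∀ S → P S)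
allSubset? P? = map′ (λ ∄¬P S → decidable-stable (P? S) (λ ¬PS → ∄¬P (S , ¬PS)))
                     (λ ∀P (S , ¬PS) → ¬PS (∀P S))
                     (¬? (anySubset? (¬? ∘ P?)))

⁅⁆⊆ : ∀ {n} {x : Fin n} {S} → x ∈ S → ⁅ x ⁆ ⊆ S
⁅⁆⊆ {x = x} {S} x∈S y∈⁅x⁆ = subst (_∈ S) (sym (x∈⁅y⁆⇒x≡y x y∈⁅x⁆)) x∈S

chain-mono : ∀ {n k} (A : Fin (suc k) → Subset n) → (∀ i → A (inject₁ i) ⊆ A (fsuc i)) →
             ∀ {i j} → i Fin.≤ j → A i ⊆ A j
chain-mono A step {fzero} {fzero} _ = id
chain-mono {k = suc k} A step {fzero} {fsuc j} _ =
  chain-mono (A ∘ fsuc) (step ∘ fsuc) {fzero} {j} z≤n ∘ step fzero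
chain-mono {k = suc k} A step {fsuc i} {fsuc j} (s≤s i≤j) = chain-mono (A ∘ fsuc) (step ∘ fsuc) i≤j

module Flats {n : ℕ} (𝓗 : SimplicialComplex n) where
  open SimplicialComplex 𝓗

  InH? : Decidable (InH 𝓗)
  InH? I = H I ≟ true

  IsFlat? : Decidable (IsFlat 𝓗)
  IsFlat? X = allSubset? λ I → InH? I →-dec I ⊆? X →-dec all? λ p → ¬? (p ∈? X) →-dec InH? (I ∪ ⁅ p ⁆)

  separated? : ∀ S p → Dec (∃ λ F → IsFlat 𝓗 F × S ⊆ F × p ∉ F)
  separated? S p = anySubset? λ F → IsFlat? F ×-dec S ⊆? F ×-dec ¬? (p ∈? F)

  cl : Subset n → Subset n
  cl S = subsetOf (¬? ∘ separated? S)

  ⊆-cl : ∀ {S} → S ⊆ cl S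
  ⊆-cl {S} p∈S = ∈-subsetOf⁺ (¬? ∘ separated? S) λ (_ , _ , S⊆F , p∉F) → p∉F (S⊆F p∈S)

  cl-least : ∀ {S F} → IsFlat 𝓗 F → S ⊆ F → cl S ⊆ F
  cl-least {S} {F} F-flat S⊆F {p} p∈clS =
    decidable-stable (p ∈? F) λ p∉F → ∈-subsetOf⁻ (¬? ∘ separated? S) p∈clS (F , F-flat , S⊆F , p∉F)

  cl-flat : ∀ {S} → IsFlat 𝓗 (cl S)
  cl-flat {S} I I∈H I⊆clS p p∉clS
    with decidable-stable (separated? S p) (p∉clS ∘ ∈-subsetOf⁺ (¬? ∘ separated? S))
  ... | F , F-flat , S⊆F , p∉F = F-flat I I∈H (cl-least F-flat S⊆F ∘ I⊆clS) p p∉F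

  ⊥ᶠ : Subset n
  ⊥ᶠ = cl ∅

  ⊥ᶠ-least : ∀ {Y} → IsFlat 𝓗 Y → ⊥ᶠ ⊆ Y
  ⊥ᶠ-least Y-flat = cl-least Y-flat ⊥⊆

  ⊆⊥ᶠ⇒bottom : ∀ {Y} → IsFlat 𝓗 Y → Y ⊆ ⊥ᶠ → IsBottomFlat 𝓗 Y
  ⊆⊥ᶠ⇒bottom Y-flat Y⊆⊥ᶠ = Y-flat , λ W W-flat → ⊆-trans Y⊆⊥ᶠ (⊥ᶠ-least W-flat)

  ∅∈H : InH 𝓗 ∅
  ∅∈H = H-closed (proj₁ H-nonempty) ∅ ⊥⊆ (proj₂ H-nonempty)

  ⟨_⟩ : Fin n → Subset n
  ⟨ q ⟩ = cl ⁅ q ⁆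

  q∈⟨q⟩ : ∀ q → q ∈ ⟨ q ⟩
  q∈⟨q⟩ q = ⊆-cl (x∈⁅x⁆ q)

  ⟨⟩-least : ∀ {q Y} → IsFlat 𝓗 Y → q ∈ Y → ⟨ q ⟩ ⊆ Y
  ⟨⟩-least Y-flat q∈Y = cl-least Y-flat (⁅⁆⊆ q∈Y)

  ⟨⟩-mono : ∀ {p q} → p ∈ ⟨ q ⟩ → ⟨ p ⟩ ⊆ ⟨ q ⟩
  ⟨⟩-mono = ⟨⟩-least cl-flat

  ∉⊥ᶠ⇒⁅⁆∈H : ∀ {p} → p ∉ ⊥ᶠ → InH 𝓗 ⁅ p ⁆
  ∉⊥ᶠ⇒⁅⁆∈H {p} p∉⊥ᶠ = subst (InH 𝓗) (∪-identityˡ ⁅ p ⁆) (cl-flat ∅ ∅∈H ⊥⊆ p p∉⊥ᶠ)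

  ∉⟨⟩⇒edge∈H : ∀ {p x} → p ∉ ⊥ᶠ → x ∉ ⟨ p ⟩ → InH 𝓗 (⁅ p ⁆ ∪ ⁅ x ⁆)
  ∉⟨⟩⇒edge∈H p∉⊥ᶠ x∉⟨p⟩ = cl-flat ⁅ _ ⁆ (∉⊥ᶠ⇒⁅⁆∈H p∉⊥ᶠ) ⊆-cl _ x∉⟨p⟩

  _∼_ : Fin n → Fin n → Set
  p ∼ q = p ∈ ⟨ q ⟩ × q ∈ ⟨ p ⟩

  _∼?_ : ∀ p q → Dec (p ∼ q)
  p ∼? q = (p ∈? ⟨ q ⟩) ×-dec (q ∈? ⟨ p ⟩)

  ∼-sym : ∀ {p q} → p ∼ q → q ∼ p
  ∼-sym (p∈⟨q⟩ , q∈⟨p⟩) = q∈⟨p⟩ , p∈⟨q⟩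

  ∼-trans : ∀ {p q r} → p ∼ q → q ∼ r → p ∼ r
  ∼-trans (p∈⟨q⟩ , q∈⟨p⟩) (q∈⟨r⟩ , r∈⟨q⟩) = ⟨⟩-mono q∈⟨r⟩ p∈⟨q⟩ , ⟨⟩-mono q∈⟨p⟩ r∈⟨q⟩

  flatChain-∉⟨⟩ : ∀ {k} {A : Fin (suc k) → Subset n} → IsFlatChain 𝓗 A →
                  ∀ {i j : Fin k} {p q} → i Fin.< j → p ∈ A (fsuc i) → q ∉ A (inject₁ j) → q ∉ ⟨ p ⟩
  flatChain-∉⟨⟩ {A = A} (A-flat , A-strict) {i} {j} i<j p∈ q∉ q∈⟨p⟩ =
    q∉ (⟨⟩-least (A-flat (inject₁ j)) (chain-mono A (proj₁ ∘ A-strict) fsuc-i≤j p∈) q∈⟨p⟩)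
    where
    fsuc-i≤j : fsuc i Fin.≤ inject₁ j
    fsuc-i≤j = subst (suc (toℕ i) ℕ.≤_) (sym (toℕ-inject₁ j)) i<j

module BooleanRepresentation {n : ℕ} (𝓗 : SimplicialComplex n) (br : BooleanRepresentable 𝓗) where
  open SimplicialComplex 𝓗
  open Flats 𝓗

  face-∉⊥ᶠ : ∀ {I p} → InH 𝓗 I → p ∈ I → p ∉ ⊥ᶠ
  face-∉⊥ᶠ {I} I∈H p∈I with br I I∈H
  ... | _ , A , (A-flat , _) , x , _ , enumerates , placed with Equivalence.to (enumerates _) p∈I
  ... | i , refl = proj₂ (placed i) ∘ ⊥ᶠ-least (A-flat (inject₁ i))

  face-∼⇒≡ : ∀ {I p q} → InH 𝓗 I → p ∈ I → q ∈ I → p ∼ q → p ≡ q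
  face-∼⇒≡ {I} I∈H p∈I q∈I (p∈⟨q⟩ , q∈⟨p⟩) with br I I∈H
  ... | _ , A , chain , x , _ , enumerates , placed
      with Equivalence.to (enumerates _) p∈I | Equivalence.to (enumerates _) q∈I
  ... | i , refl | j , refl with <-cmp i j
  ... | tri< i<j _ _ = ⊥-elim (flatChain-∉⟨⟩ chain i<j (proj₁ (placed i)) (proj₂ (placed j)) q∈⟨p⟩)
  ... | tri≈ _ refl _ = refl
  ... | tri> _ _ j<i = ⊥-elim (flatChain-∉⟨⟩ chain j<i (proj₁ (placed j)) (proj₂ (placed i)) p∈⟨q⟩)

  class : Fin n → Subset n
  class q = subsetOf (_∼? q)

  -- A face inside ⊥ᶠ ∪ class q consists of points ∼ q, so by face-∼⇒≡ it has at most one point.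
  ⊥ᶠ∪class-flat : ∀ q → IsFlat 𝓗 (⊥ᶠ ∪ class q)
  ⊥ᶠ∪class-flat q I I∈H I⊆⊥ᶠ∪class p p∉⊥ᶠ∪class = extend (any? (_∈? I))
    where
    p∉⊥ᶠ : p ∉ ⊥ᶠ
    p∉⊥ᶠ = p∉⊥ᶠ∪class ∘ x∈p∪q⁺ ∘ inj₁

    ∼q : ∀ {y} → y ∈ I → y ∼ q
    ∼q y∈I with x∈p∪q⁻ ⊥ᶠ (class q) (I⊆⊥ᶠ∪class y∈I)
    ... | inj₁ y∈⊥ᶠ = ⊥-elim (face-∉⊥ᶠ I∈H y∈I y∈⊥ᶠ)
    ... | inj₂ y∈class = ∈-subsetOf⁻ (_∼? q) y∈class

    extend-from : ∀ {x} → x ∈ I → Dec (p ∈ ⟨ x ⟩) → InH 𝓗 (I ∪ ⁅ p ⁆)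
    extend-from x∈I (no p∉⟨x⟩) = cl-flat I I∈H (λ y∈I → ⟨⟩-mono (proj₂ (∼q x∈I)) (proj₁ (∼q y∈I))) _ p∉⟨x⟩
    extend-from {x} x∈I (yes p∈⟨x⟩) =
      H-closed (⁅ p ⁆ ∪ ⁅ x ⁆) (I ∪ ⁅ p ⁆) I∪⁅p⁆⊆edge (∉⟨⟩⇒edge∈H p∉⊥ᶠ x∉⟨p⟩)
      where
      x∉⟨p⟩ : x ∉ ⟨ p ⟩
      x∉⟨p⟩ x∈⟨p⟩ = p∉⊥ᶠ∪class (x∈p∪q⁺ (inj₂ (∈-subsetOf⁺ (_∼? q) (∼-trans (p∈⟨x⟩ , x∈⟨p⟩) (∼q x∈I)))))
      I⊆⁅x⁆ : I ⊆ ⁅ x ⁆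
      I⊆⁅x⁆ y∈I = subst (_∈ ⁅ x ⁆) (sym (face-∼⇒≡ I∈H y∈I x∈I (∼-trans (∼q y∈I) (∼-sym (∼q x∈I))))) (x∈⁅x⁆ x)
      I∪⁅p⁆⊆edge : I ∪ ⁅ p ⁆ ⊆ ⁅ p ⁆ ∪ ⁅ x ⁆
      I∪⁅p⁆⊆edge = [ x∈p∪q⁺ ∘ inj₂ ∘ I⊆⁅x⁆ , x∈p∪q⁺ ∘ inj₁ ]′ ∘ x∈p∪q⁻ I ⁅ p ⁆

    extend : Dec (∃ (_∈ I)) → InH 𝓗 (I ∪ ⁅ p ⁆)
    extend (no I-empty) = cl-flat I I∈H (λ y∈I → ⊥-elim (I-empty (_ , y∈I))) p p∉⊥ᶠ
    extend (yes (x , x∈I)) = extend-from x∈I (p ∈? ⟨ x ⟩)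

  ∈⟨⟩⇒∼ : ∀ {q r} → r ∈ ⟨ q ⟩ → r ∉ ⊥ᶠ → r ∼ q
  ∈⟨⟩⇒∼ {q} r∈⟨q⟩ r∉⊥ᶠ with x∈p∪q⁻ ⊥ᶠ (class q) (⟨⟩-least (⊥ᶠ∪class-flat q) q∈⊥ᶠ∪class r∈⟨q⟩)
    where q∈⊥ᶠ∪class = x∈p∪q⁺ (inj₂ (∈-subsetOf⁺ (_∼? q) (q∈⟨q⟩ q , q∈⟨q⟩ q)))
  ... | inj₁ r∈⊥ᶠ = ⊥-elim (r∉⊥ᶠ r∈⊥ᶠ)
  ... | inj₂ r∈class = ∈-subsetOf⁻ (_∼? q) r∈class

  ⟨⟩-atom : ∀ {q} → q ∉ ⊥ᶠ → IsAtom 𝓗 ⟨ q ⟩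
  ⟨⟩-atom {q} q∉⊥ᶠ = cl-flat , not-bottom , covers
    where
    not-bottom : ¬ IsBottomFlat 𝓗 ⟨ q ⟩
    not-bottom (_ , least) = q∉⊥ᶠ (least ⊥ᶠ cl-flat (q∈⟨q⟩ q))

    covers : ∀ Y → IsFlat 𝓗 Y → Y ⊆ ⟨ q ⟩ → IsBottomFlat 𝓗 Y ⊎ Y ≡ ⟨ q ⟩
    covers Y Y-flat Y⊆⟨q⟩ with any? (λ r → (r ∈? Y) ×-dec ¬? (r ∈? ⊥ᶠ))
    ... | yes (r , r∈Y , r∉⊥ᶠ) =
      inj₂ (⊆-antisym Y⊆⟨q⟩ (⟨⟩-least Y-flat (⟨⟩-least Y-flat r∈Y (proj₂ (∈⟨⟩⇒∼ (Y⊆⟨q⟩ r∈Y) r∉⊥ᶠ)))))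
    ... | no ∄r = inj₁ (⊆⊥ᶠ⇒bottom Y-flat λ {y} y∈Y → decidable-stable (y ∈? ⊥ᶠ) λ y∉⊥ᶠ → ∄r (y , y∈Y , y∉⊥ᶠ))

  atoms-cover : (∀ p → InH 𝓗 ⁅ p ⁆) → VIsUnionOfAtoms 𝓗
  atoms-cover ⁅⁆∈H p = ⟨ p ⟩ , ⟨⟩-atom (face-∉⊥ᶠ (⁅⁆∈H p) (x∈⁅x⁆ p)) , q∈⟨q⟩ p

  atomistic : Atomistic 𝓗
  atomistic X X-flat = map ⟨_⟩ generators , All.tabulate atom , X-flat , upper , least
    where
    generating? : ∀ p → Dec (p ∈ X × p ∉ ⊥ᶠ)
    generating? p = (p ∈? X) ×-dec ¬? (p ∈? ⊥ᶠ)

    generators : List (Fin n)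
    generators = filter generating? (allFin n)

    generating : ∀ {q} → q ∈L generators → q ∈ X × q ∉ ⊥ᶠ
    generating = proj₂ ∘ ∈-filter⁻ generating? {xs = allFin n}

    atom : ∀ {A} → A ∈L map ⟨_⟩ generators → IsAtom 𝓗 A
    atom A∈ with ∈-map⁻ ⟨_⟩ A∈
    ... | q , q∈gens , refl = ⟨⟩-atom (proj₂ (generating q∈gens))

    upper : ∀ A → A ∈L map ⟨_⟩ generators → A ⊆ X
    upper A A∈ with ∈-map⁻ ⟨_⟩ A∈
    ... | q , q∈gens , refl = ⟨⟩-least X-flat (proj₁ (generating q∈gens))

    least : ∀ Y → IsFlat 𝓗 Y → (∀ A → A ∈L map ⟨_⟩ generators → A ⊆ Y) → X ⊆ Y
    least Y Y-flat ub {p} p∈X with p ∈? ⊥ᶠ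
    ... | yes p∈⊥ᶠ = ⊥ᶠ-least Y-flat p∈⊥ᶠ
    ... | no p∉⊥ᶠ = ub ⟨ p ⟩ (∈-map⁺ ⟨_⟩ (∈-filter⁺ generating? (∈-allFin p) (p∈X , p∉⊥ᶠ))) (q∈⟨q⟩ p)

theorem4p3 : ∀ {n : ℕ} (𝓗 : SimplicialComplex n) → BooleanRepresentable 𝓗 →
    (((∀ (p : Fin n) → InH 𝓗 ⁅ p ⁆) → VIsUnionOfAtoms 𝓗) × Atomistic 𝓗)
theorem4p3 𝓗 br = atoms-cover , atomistic
  where open BooleanRepresentation 𝓗 br
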